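{- Let $t\ge2$, $k\ge2$ and $\ell\ge t$ be integers, and let $T$ be the complete $t$-ary tree with $k$ layers, with an input $\pi$ and associated set-cover instance $\mathcal{I}(\pi)$ as defined in the context. Let $v_\pi$ be the leaf reached by starting at the root $r$ and repeatedly following $\pi$. Then: (1) if $b(v_\pi)=1$, there is a subfamily $\mathcal{F}$ of the sets of $\mathcal{I}(\pi)$ with $|\mathcal{F}|=k$ and $f(\mathcal{F})=Q$; (2) if $b(v_\pi)=0$, every subfamily $\mathcal{F}$ of the sets of $\mathcal{I}(\pi)$ with $|\mathcal{F}|<\ell$ satisfies $f(\mathcal{F})<Q$.
   Context: Layers of $T$: the leaves form layer $\mathcal{V}_1$, and layer $\mathcal{V}_i$ consists of vertices at distance $k-i$ from the root, so the root $r$ is the unique vertex of $\mathcal{V}_k$ and $|\mathcal{V}_i|=t^{k-i}$. Let $\mathcal{X}$ be a universe with $|\mathcal{X}|=\ell t^{k-1}$, partitioned into $t^{k-1}$ disjoint blocks of size $\ell$, one assigned to each leaf $v$ and denoted $\tilde S_v$; for a non-leaf $v$, $\tilde S_v$ is the union of $\tilde S_c$ over the children $c$ of $v$ (so $\tilde S_r=\mathcal{X}$). An input $\pi$ specifies, for each non-leaf vertex $v$, one child $\pi(v)$ of $v$, and for each leaf $v$, a bit $b(v)\in\{0,1\}$. The instance $\mathcal{I}(\pi)$ is the following (indexed) family of subsets of $\mathcal{X}$: the set $S_r=\tilde S_r\setminus\tilde S_{\pi(r)}$ together with the singleton $\{e\}$ for each $e\in\tilde S_{\pi(r)}$; for each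 vertex $v$ in layers $2,\dots,k-1$, the set $S_v=\tilde S_v\setminus\tilde S_{\pi(v)}$; and for each leaf $v$ with $b(v)=1$, the set $S_v=\tilde S_v$ (leaves with $b(v)=0$ contribute no set). For a subfamily $\mathcal{F}$, $f(\mathcal{F})=\left|\bigcup_{S\in\mathcal{F}}S\right|$, and $Q=\ell t^{k-1}$. -}

module Defs where

open import Data.Nat using (ℕ; zero; suc)
open import Data.Fin using (Fin; toℕ; _≟_)
open import Data.Bool using (Bool; true; false; _∧_; _∨_; not; T)
open import Data.Product using (_×_; _,_; proj₁; proj₂)
open import Data.Vec.Properties using (≡-dec)
open import Data.Vec using (Vec; []; _∷_; _∷ʳ_)
open import Data.List using (List; []; _∷_; map; cartesianProduct; allFin; filterᵇ; length; concatMap)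
open import Data.Bool.ListAction using (any)
open import Relation.Nullary.Decidable using (⌊_⌋)

-- The number of layers is k = n + 2 (so k ≥ 2).
-- A vertex at depth d (distance d from the root, i.e. in layer k - d) is the
-- path from the root to it: a vector in Vec (Fin t) d.  Leaves have depth n + 1 = k - 1.
-- The child number c of vertex v is  v ∷ʳ c.

isPrefix : ∀ {t d m} → Vec (Fin t) d → Vec (Fin t) m → Bool
isPrefix []       _        = true
isPrefix (x ∷ xs) []       = false
isPrefix (x ∷ xs) (y ∷ ys) = ⌊ x ≟ y ⌋ ∧ isPrefix xs ys

allVecs : ∀ t m → List (Vec (Fin t) m)
allVecs t zero    = [] ∷ []
allVecs t (suc m) = concatMap (λ x → map (x ∷_) (allVecs t m)) (allFin t)

-- Universe X: each element is (leaf, position in the leaf's block of size ℓ).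
Elem : ℕ → ℕ → ℕ → Set
Elem t n ℓ = Vec (Fin t) (suc n) × Fin ℓ

universe : ∀ t n ℓ → List (Elem t n ℓ)
universe t n ℓ = cartesianProduct (allVecs t (suc n)) (allFin ℓ)

-- x ∈ S̃_v   (the block of x lies below v)
inTilde : ∀ {t n ℓ d} → Vec (Fin t) d → Elem t n ℓ → Bool
inTilde v x = isPrefix v (proj₁ x)

-- An input π.  'choice d v' is the chosen child π(v) of the vertex v of depth d;
-- only depths d ≤ n (the non-leaf vertices) are ever used.
record Input (t n : ℕ) : Set where
  field
    choice : (d : ℕ) → Vec (Fin t) d → Fin t
    bit    : Vec (Fin t) (suc n) → Bool
open Input public

πchild : ∀ {t n d} → Input t n → Vec (Fin t) d → Vec (Fin t) (suc d)
πchild {d = d} π v = v ∷ʳ choice π d v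

walk : ∀ {t n} → Input t n → (d : ℕ) → Vec (Fin t) d
walk π zero    = []
walk π (suc d) = πchild π (walk π d)

leafπ : ∀ {t n} → Input t n → Vec (Fin t) (suc n)
leafπ {n = n} π = walk π (suc n)

data SetIdx (t n ℓ : ℕ) (π : Input t n) : Set where
  -- S_r = S̃_r ∖ S̃_{π(r)}
  rootSet  : SetIdx t n ℓ π
  -- the singleton {e} for e ∈ S̃_{π(r)}
  single   : (e : Elem t n ℓ) → T (inTilde (πchild π []) e) → SetIdx t n ℓ π
  -- S_v for a vertex v at depth suc j ∈ {1,…,n}, i.e. in layers 2,…,k-1
  internal : (j : Fin n) (v : Vec (Fin t) (suc (toℕ j))) → SetIdx t n ℓ π
  -- S_v = S̃_v for a leaf v with b(v) = 1
  leaf     : (v : Vec (Fin t) (suc n)) → T (bit π v) → SetIdx t n ℓ π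

member : ∀ {t n ℓ π} → SetIdx t n ℓ π → Elem t n ℓ → Bool
member {π = π} rootSet        x = not (inTilde (πchild π []) x)
member         (single e _)   x = ⌊ ≡-dec _≟_ (proj₁ e) (proj₁ x) ⌋ ∧ ⌊ proj₂ e ≟ proj₂ x ⌋
member {π = π} (internal j v) x = inTilde v x ∧ not (inTilde (πchild π v) x)
member         (leaf v _)     x = inTilde v x

f : ∀ {t n ℓ π} → List (SetIdx t n ℓ π) → ℕ
f {t} {n} {ℓ} F = length (filterᵇ (λ x → any (λ s → member s x) F) (universe t n ℓ))

-- If b(v_π) = 1, the root set, the sets S_v along the path of π and the leaf set of v_π
-- cover X: an element leaves the path of π at some first vertex, and the set of the
-- vertex just above that point contains it.  If b(v_π) = 0, the ℓ elements of the block
-- of v_π lie in no set except their own singletons, so fewer than ℓ sets miss one of them.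

module Submission where

open import Defs
open import Data.Nat using (ℕ; _≤_; _<_; _*_; _^_; _∸_; zero; suc; _+_; z≤n; s≤s)
open import Data.Nat.Properties using (*-comm; ≤-refl; ≤-trans; n≤1+n; ≤-pred; m≤n⇒m<n∨m≡n)
open import Data.Bool using (true; false; _∧_; not; T)
open import Data.Bool.Properties using (T?; T-∧)
open import Data.Bool.ListAction using (any)
open import Data.Product using (Σ; ∃; _×_; _,_; proj₂)
open import Data.Sum using (_⊎_; inj₁; inj₂)
open import Data.Maybe using (Maybe; just; nothing)
open import Data.Maybe.Properties using (just-injective)
open import Data.Fin using (Fin; toℕ; fromℕ<; _≟_)
open import Data.Fin.Properties using (toℕ-fromℕ<; toℕ<n; pigeonhole; ¬∀⟶∃¬; <⇒≢)
open import Data.Vec using (Vec; []; _∷_; _∷ʳ_)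
open import Data.List using (List; []; _∷_; length; map; _++_; concatMap; cartesianProduct; allFin; lookup)
open import Data.List.Properties using (length-map; length-++; length-tabulate; filter-all; filter-notAll)
open import Data.List.Relation.Unary.Any as Any using (Any; here; there)
open import Data.List.Relation.Unary.Any.Properties using (any⁺; any⁻; lookup-index)
import Data.List.Relation.Unary.All as All
import Data.List.Relation.Unary.All.Properties as All
open import Data.List.Relation.Unary.AllPairs using (_∷_)
open import Data.List.Relation.Unary.Unique.Propositional using (Unique)
import Data.List.Relation.Unary.Unique.Propositional.Properties as Unique
open import Data.List.Membership.Propositional using (_∈_; lose)
open import Data.List.Membership.Propositional.Properties
  using (∈-allFin; ∈-map⁺; ∈-concatMap⁺; ∈-cartesianProduct⁺)
open import Data.Empty using (⊥-elim)
open import Function using (_∘_; Equivalence)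
open import Relation.Nullary using (¬_; yes; no)
open import Relation.Nullary.Decidable using (⌊_⌋; toWitness)
open import Relation.Binary.PropositionalEquality
  using (_≡_; refl; sym; trans; cong; cong₂; subst; module ≡-Reasoning)

length-concatMap-const : ∀ {A B : Set} (g : A → List B) c (xs : List A) →
  (∀ x → length (g x) ≡ c) → length (concatMap g xs) ≡ length xs * c
length-concatMap-const g c []       _     = refl
length-concatMap-const g c (x ∷ xs) |g|≡c = begin
  length (g x ++ concatMap g xs)         ≡⟨ length-++ (g x) ⟩
  length (g x) + length (concatMap g xs) ≡⟨ cong₂ _+_ (|g|≡c x) (length-concatMap-const g c xs |g|≡c) ⟩
  c + length xs * c                      ∎
  where open ≡-Reasoning

length-cartesianProduct : ∀ {A B : Set} (xs : List A) (ys : List B) →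
  length (cartesianProduct xs ys) ≡ length xs * length ys
length-cartesianProduct []       ys = refl
length-cartesianProduct (x ∷ xs) ys = begin
  length (map (x ,_) ys ++ cartesianProduct xs ys)
    ≡⟨ length-++ (map (x ,_) ys) ⟩
  length (map (x ,_) ys) + length (cartesianProduct xs ys)
    ≡⟨ cong₂ _+_ (length-map (x ,_) ys) (length-cartesianProduct xs ys) ⟩
  length ys + length xs * length ys ∎
  where open ≡-Reasoning

length-allFin : ∀ n → length (allFin n) ≡ n
length-allFin n = length-tabulate {n = n} (λ i → i)

T-∧-not : ∀ {a b} → T a → ¬ T b → T (a ∧ not b)
T-∧-not {true} {false} _ _  = _
T-∧-not {true} {true}  _ ¬b = ¬b _

¬T⇒T-not : ∀ {b} → ¬ T b → T (not b)
¬T⇒T-not {false} _  = _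
¬T⇒T-not {true}  ¬b = ¬b _

T-not⇒¬T : ∀ {b} → T (not b) → ¬ T b
T-not⇒¬T {false} _ ()

short-list-misses : ∀ {A : Set} {m} (label : A → Maybe (Fin m)) (F : List A) → length F < m →
  ¬ (∀ i → Any (λ s → label s ≡ just i) F)
short-list-misses label F |F|<m hits with pigeonhole |F|<m (Any.index ∘ hits)
... | i , j , i<j , same = <⇒≢ i<j (just-injective (begin
  just i                                ≡⟨ sym (lookup-index (hits i)) ⟩
  label (lookup F (Any.index (hits i))) ≡⟨ cong (label ∘ lookup F) same ⟩
  label (lookup F (Any.index (hits j))) ≡⟨ lookup-index (hits j) ⟩
  just j                                ∎))
  where open ≡-Reasoning

length-allVecs : ∀ t m → length (allVecs t m) ≡ t ^ m
length-allVecs t zero    = refl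
length-allVecs t (suc m) = begin
  length (concatMap prepend (allFin t)) ≡⟨ length-concatMap-const prepend (t ^ m) (allFin t) |prepend| ⟩
  length (allFin t) * t ^ m             ≡⟨ cong (_* t ^ m) (length-allFin t) ⟩
  t * t ^ m                             ∎
  where
  open ≡-Reasoning
  prepend : Fin t → List (Vec (Fin t) (suc m))
  prepend x = map (x ∷_) (allVecs t m)
  |prepend| : ∀ x → length (prepend x) ≡ t ^ m
  |prepend| x = trans (length-map (x ∷_) (allVecs t m)) (length-allVecs t m)

∈-allVecs : ∀ {t m} (v : Vec (Fin t) m) → v ∈ allVecs t m
∈-allVecs []      = here refl
∈-allVecs {t} {suc m} (x ∷ v) =
  ∈-concatMap⁺ (λ y → map (y ∷_) (allVecs t m)) (lose (∈-allFin x) (∈-map⁺ (x ∷_) (∈-allVecs v)))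

length-universe : ∀ t n ℓ → length (universe t n ℓ) ≡ ℓ * t ^ suc n
length-universe t n ℓ = begin
  length (cartesianProduct (allVecs t (suc n)) (allFin ℓ))
    ≡⟨ length-cartesianProduct (allVecs t (suc n)) (allFin ℓ) ⟩
  length (allVecs t (suc n)) * length (allFin ℓ)
    ≡⟨ cong₂ _*_ (length-allVecs t (suc n)) (length-allFin ℓ) ⟩
  t ^ suc n * ℓ
    ≡⟨ *-comm (t ^ suc n) ℓ ⟩
  ℓ * t ^ suc n ∎
  where open ≡-Reasoning

∈-universe : ∀ {t n ℓ} (x : Elem t n ℓ) → x ∈ universe t n ℓ
∈-universe (v , i) = ∈-cartesianProduct⁺ (∈-allVecs v) (∈-allFin i)

module _ {t n ℓ : ℕ} {π : Input t n} where

  Covers : List (SetIdx t n ℓ π) → Elem t n ℓ → Set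
  Covers F x = T (any (λ s → member s x) F)

  f-covering : (F : List (SetIdx t n ℓ π)) → (∀ x → Covers F x) → f F ≡ ℓ * t ^ suc n
  f-covering F covers = trans
    (cong length (filter-all (T? ∘ λ x → any (λ s → member s x) F) (All.universal covers (universe t n ℓ))))
    (length-universe t n ℓ)

  f-missing : (F : List (SetIdx t n ℓ π)) (x : Elem t n ℓ) → ¬ Covers F x → f F < ℓ * t ^ suc n
  f-missing F x missed = subst (f F <_) (length-universe t n ℓ)
    (filter-notAll (T? ∘ λ x → any (λ s → member s x) F) (universe t n ℓ) (lose (∈-universe x) missed))

isPrefix-refl : ∀ {t d} (v : Vec (Fin t) d) → T (isPrefix v v)
isPrefix-refl []      = _
isPrefix-refl (x ∷ v) with x ≟ x
... | yes _  = isPrefix-refl v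
... | no x≢x = x≢x refl

isPrefix-∷ʳ : ∀ {t d m} (v : Vec (Fin t) d) (w : Vec (Fin t) m) c → T (isPrefix v w) → T (isPrefix v (w ∷ʳ c))
isPrefix-∷ʳ []      w       c _ = _
isPrefix-∷ʳ (x ∷ v) (y ∷ w) c p with x ≟ y
... | yes _ = isPrefix-∷ʳ v w c p

isPrefix-unique : ∀ {t d m} (v v′ : Vec (Fin t) d) (w : Vec (Fin t) m) →
  T (isPrefix v w) → T (isPrefix v′ w) → v ≡ v′
isPrefix-unique []      []        w       _ _ = refl
isPrefix-unique (x ∷ v) (x′ ∷ v′) (y ∷ w) p p′ with x ≟ y | x′ ≟ y
... | yes refl | yes refl = cong (x ∷_) (isPrefix-unique v v′ w p p′)

walk-isPrefix : ∀ {t n} (π : Input t n) {d e} → d ≤ e → T (isPrefix (walk π d) (walk π e))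
walk-isPrefix π {e = zero}  z≤n = _
walk-isPrefix π {d} {suc e} d≤1+e with m≤n⇒m<n∨m≡n d≤1+e
... | inj₁ d<1+e = isPrefix-∷ʳ (walk π d) (walk π e) (choice π e (walk π e)) (walk-isPrefix π (≤-pred d<1+e))
... | inj₂ refl  = isPrefix-refl (walk π (suc e))

module _ {t n : ℕ} (π : Input t n) {ℓ : ℕ} where

  OnPath : ℕ → Vec (Fin t) (suc n) → Set
  OnPath d w = T (isPrefix (walk π d) w)

  pathSet : Fin n → SetIdx t n ℓ π
  pathSet j = internal j (walk π (suc (toℕ j)))

  pathCover : T (bit π (leafπ π)) → List (SetIdx t n ℓ π)
  pathCover b = rootSet ∷ leaf (leafπ π) b ∷ map pathSet (allFin n)

  length-pathCover : ∀ b → length (pathCover b) ≡ suc (suc n)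
  length-pathCover b = cong (suc ∘ suc) (trans (length-map pathSet (allFin n)) (length-allFin n))

  pathCover-unique : ∀ b → Unique (pathCover b)
  pathCover-unique b =
      ((λ ()) All.∷ All.map⁺ (All.universal (λ _ ()) (allFin n)))
    ∷ All.map⁺ (All.universal (λ _ ()) (allFin n))
    ∷ Unique.map⁺ pathSet-injective (Unique.allFin⁺ n)
    where
    pathSet-injective : ∀ {i j} → pathSet i ≡ pathSet j → i ≡ j
    pathSet-injective refl = refl

  member-pathSet : ∀ j {d} → toℕ j ≡ d → (w : Vec (Fin t) (suc n)) (i : Fin ℓ) →
    OnPath (suc d) w → ¬ OnPath (suc (suc d)) w → T (member (pathSet j) (w , i))
  member-pathSet j refl w i = T-∧-not

  module _ (b : T (bit π (leafπ π))) where

    covered-by : ∀ x s → s ∈ pathCover b → T (member s x) → Covers (pathCover b) x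
    covered-by x s s∈F = any⁺ (λ s → member s x) ∘ lose s∈F

    onPath-or-covered : (w : Vec (Fin t) (suc n)) (i : Fin ℓ) → ∀ d → d ≤ n →
      OnPath (suc d) w ⊎ Covers (pathCover b) (w , i)
    onPath-or-covered w i zero _ with T? (isPrefix (walk π 1) w)
    ... | yes onPath = inj₁ onPath
    ... | no  offPath = inj₂ (covered-by (w , i) rootSet (here refl) (¬T⇒T-not offPath))
    onPath-or-covered w i (suc d) d<n with onPath-or-covered w i d (≤-trans (n≤1+n d) d<n)
    ... | inj₂ covered = inj₂ covered
    ... | inj₁ onPath with T? (isPrefix (walk π (suc (suc d))) w)
    ...   | yes onPath′ = inj₁ onPath′
    ...   | no  offPath = inj₂ (covered-by (w , i) (pathSet j) (there (there (∈-map⁺ pathSet (∈-allFin j))))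
                                  (member-pathSet j (toℕ-fromℕ< d<n) w i onPath offPath))
      where j = fromℕ< d<n

    pathCover-covers : ∀ x → Covers (pathCover b) x
    pathCover-covers (w , i) with onPath-or-covered w i n ≤-refl
    ... | inj₁ onPath  = covered-by (w , i) (leaf (leafπ π) b) (there (here refl)) onPath
    ... | inj₂ covered = covered

  singletonPosition : SetIdx t n ℓ π → Maybe (Fin ℓ)
  singletonPosition (single e _) = just (proj₂ e)
  singletonPosition _            = nothing

  module _ (b≡false : bit π (leafπ π) ≡ false) where

    -- The block of v_π lies below every vertex of the path of π, so the root and path sets
    -- remove it entirely, and the only leaf set that could contain it is absent.
    member-leafBlock : ∀ s i → T (member s (leafπ π , i)) → singletonPosition s ≡ just i
    member-leafBlock rootSet i m = ⊥-elim (T-not⇒¬T m (walk-isPrefix π {1} {suc n} (s≤s z≤n)))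
    member-leafBlock (single e _) i m = cong just (toWitness (proj₂ (Equivalence.to (T-∧ {y = ⌊ proj₂ e ≟ i ⌋}) m)))
    member-leafBlock (internal j v) i m
      with onV , offπV ← Equivalence.to (T-∧ {isPrefix v (leafπ π)}) m
      with refl ← isPrefix-unique v (walk π (suc (toℕ j))) (leafπ π) onV
                    (walk-isPrefix π (≤-trans (toℕ<n j) (n≤1+n n)))
      = ⊥-elim (T-not⇒¬T offπV (walk-isPrefix π (s≤s (toℕ<n j))))
    member-leafBlock (leaf v bv) i m
      with refl ← isPrefix-unique v (leafπ π) (leafπ π) m (isPrefix-refl (leafπ π))
      = ⊥-elim (subst T b≡false bv)

    leafBlock-uncovered : (F : List (SetIdx t n ℓ π)) → length F < ℓ → ∃ λ i → ¬ Covers F (leafπ π , i)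
    leafBlock-uncovered F |F|<ℓ = ¬∀⟶∃¬ ℓ (λ i → Covers F (leafπ π , i)) (λ i → T? _)
      λ covers → short-list-misses singletonPosition F |F|<ℓ λ i →
        Any.map (member-leafBlock _ i) (any⁻ _ F (covers i))

claim1 : (t k ℓ : ℕ) → 2 ≤ t → 2 ≤ k → t ≤ ℓ → (π : Input t (k ∸ 2)) →
    (bit π (leafπ π) ≡ true →
      Σ (List (SetIdx t (k ∸ 2) ℓ π)) λ F →
        Unique F × length F ≡ k × f F ≡ ℓ * t ^ (k ∸ 1))
    × (bit π (leafπ π) ≡ false →
      (F : List (SetIdx t (k ∸ 2) ℓ π)) → Unique F → length F < ℓ →
        f F < ℓ * t ^ (k ∸ 1))
claim1 t (suc zero) ℓ _ (s≤s ()) _ π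
claim1 t (suc (suc n)) ℓ _ _ _ π =
    (λ b≡true → let b = subst T (sym b≡true) _ in
      pathCover π b , pathCover-unique π b , length-pathCover π b ,
      f-covering (pathCover π b) (pathCover-covers π b))
  , λ b≡false F _ |F|<ℓ → f-missing F _ (proj₂ (leafBlock-uncovered π b≡false F |F|<ℓ))
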